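{- For all integers $m\geq 1$ and $n\geq 2$ there exists a partition $\Pi=\{V_1,\dots,V_m\}$ of the vertex set of the Hamming graph $H(n,m)$ into $m$ sets such that $\Delta(\Pi)\leq 1$ and \[ \iota(\Pi)\geq \begin{cases} m-2 & \text{if } m \text{ is even},\\ m-1 & \text{if } m \text{ is odd}.\end{cases} \]
   Context: The Hamming graph $H(n,m)$ has vertex set $\{0,\dots,m-1\}^n$, two vertices being adjacent iff they differ in exactly one coordinate. A partition $\Pi=\{V_1,\dots,V_m\}$ of its vertex set into $m$ sets means $m$ pairwise disjoint (possibly empty) sets whose union is the vertex set. The maximum degree $\Delta(\Pi)$ is the maximum over $i$ of the maximum degree of the subgraph of $H(n,m)$ induced by $V_i$. The imbalance is $\iota(\Pi)=\sum_{i=1}^m \bigl||V_i|-m^{n-1}\bigr|$. -}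

module Defs where

open import Data.Nat using (ℕ; zero; suc; _+_; _^_; ∣_-_∣; _∸_)
open import Data.Fin using (Fin)
open import Data.Fin.Properties using () renaming (_≟_ to _≟ᶠ_)
open import Data.Vec using (Vec; []; _∷_)
open import Data.List using (List; []; _∷_; map; concatMap; allFin; length; filter)
open import Data.Nat.ListAction using (sum)
open import Data.Product using (_×_)
open import Relation.Nullary using (¬_; Dec; yes; no)
open import Relation.Nullary.Decidable using (_×-dec_; ¬?)
open import Relation.Binary.PropositionalEquality using (_≡_)
open import Data.Nat.Properties using () renaming (_≟_ to _≟ℕ_)

Vertex : ℕ → ℕ → Set
Vertex n m = Vec (Fin m) n

allVertices : (n m : ℕ) → List (Vertex n m)
allVertices zero    m = [] ∷ []
allVertices (suc n) m = concatMap (λ a → map (a ∷_) (allVertices n m)) (allFin m)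

hammingDist : ∀ {n m} → Vertex n m → Vertex n m → ℕ
hammingDist []       []       = 0
hammingDist (a ∷ u) (b ∷ v) with a ≟ᶠ b
... | yes _ = hammingDist u v
... | no  _ = suc (hammingDist u v)

Adjacent : ∀ {n m} → Vertex n m → Vertex n m → Set
Adjacent u v = hammingDist u v ≡ 1

adjacent? : ∀ {n m} (u v : Vertex n m) → Dec (Adjacent u v)
adjacent? u v = hammingDist u v ≟ℕ 1

-- A partition {V_1,…,V_m} of the vertex set into m (possibly empty) sets,
-- given by the labelling c : vertex ↦ index of its part, i.e. V_i = c⁻¹(i).
Partition : ℕ → ℕ → Set
Partition n m = Vertex n m → Fin m

partSize : ∀ {n m} → Partition n m → Fin m → ℕ
partSize {n} {m} c i = length (filter (λ v → c v ≟ᶠ i) (allVertices n m))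

inducedDegree : ∀ {n m} → Partition n m → Vertex n m → ℕ
inducedDegree {n} {m} c v =
  length (filter (λ w → adjacent? v w ×-dec (c w ≟ᶠ c v)) (allVertices n m))

-- Δ(Π) ≤ d : every vertex has at most d neighbours in its own part
-- (equivalently, the max over i of the max degree of H[V_i] is ≤ d).
MaxDegreeAtMost : ∀ {n m} → Partition n m → ℕ → Set
MaxDegreeAtMost {n} {m} c d = ∀ (v : Vertex n m) → inducedDegree c v Data.Nat.≤ d

imbalance : ∀ {n m} → Partition n m → ℕ
imbalance {n} {m} c = sum (map (λ i → ∣ partSize c i - m ^ (n ∸ 1) ∣) (allFin m))

-- Label a word by the sum of its coordinates, except that its first nonzero coordinate x
-- contributes only ⌈ x /2⌉, and put it into the part given by its label mod m.  Neighbours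
-- differing anywhere but in that leading coordinate get labels that differ by a nonzero
-- amount below m, so a vertex shares its part only with the word whose leading coordinate is
-- the other member of its pair {2k-1, 2k}: Δ ≤ 1.  Words with a nonzero coordinate before the
-- last one are spread evenly over the parts, whereas among the m words 0⋯0x each of the parts
-- 1, …, ⌊(m-1)/2⌋ receives two; these parts exceed the average m^(n-1), so ι ≥ 2⌊(m-1)/2⌋.
module Submission where

open import Defs
open import Data.Nat using (ℕ; _≤_; _∸_)
open import Data.Nat.Divisibility using (_∣_)
open import Data.Product using (Σ; _×_)
open import Relation.Nullary using (¬_)

open import Data.Fin using (Fin; zero; suc; toℕ; fromℕ<)
open import Data.Fin.Properties using (toℕ-injective; toℕ-fromℕ<; toℕ<n) renaming (_≟_ to _≟ᶠ_)
open import Data.List using (List; []; _∷_; [_]; _++_; map; concatMap; allFin; length; filter; tabulate)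
open import Data.List.Membership.Propositional using (_∈_)
open import Data.List.Membership.Propositional.Properties using (∈-allFin; ∈-filter⁺; ∈-filter⁻; ∈-concat⁺′; ∈-map⁺; ∈-map⁻)
open import Data.List.Properties using (filter-++; filter-some; filter-≐; length-++; length-map; length-tabulate; map-cong; map-tabulate)
open import Data.List.Relation.Binary.Disjoint.Propositional using (Disjoint)
import Data.List.Relation.Unary.All as All
import Data.List.Relation.Unary.All.Properties as AllP
open import Data.List.Relation.Unary.All using ([]; _∷_)
import Data.List.Relation.Unary.AllPairs as AllPairs
import Data.List.Relation.Unary.AllPairs.Properties as AllPairsP
open import Data.List.Relation.Unary.AllPairs using ([]; _∷_)
open import Data.List.Relation.Unary.Any using (here; there)
open import Data.List.Relation.Unary.Unique.Propositional using (Unique)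
import Data.List.Relation.Unary.Unique.Propositional.Properties as Unique
open import Data.Nat using (zero; suc; _+_; _*_; _^_; _<_; z≤n; s≤s; z<s; _%_; _/_; ⌊_/2⌋; ⌈_/2⌉; ∣_-_∣; NonZero)
open import Data.Nat.DivMod using (_mod_; m%n<n; m<n⇒m%n≡m; m≡m%n+[m/n]*n)
open import Data.Nat.Divisibility using (∣m+n∣m⇒∣n; ∣m∣n⇒∣m+n; ∣-refl; n∣m*n; ∣⇒≤)
open import Data.Nat.ListAction using (sum)
open import Data.Nat.Properties
open import Algebra.Properties.CommutativeSemigroup +-commutativeSemigroup using (interchange; xy∙z≈xz∙y; x∙yz≈y∙xz)
open import Data.Product using (_,_; proj₂)
open import Data.Sum using (_⊎_; inj₁; inj₂)
open import Data.Vec using ([]; _∷_)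
import Data.Vec as Vec
open import Data.Vec.Properties using (∷-injectiveˡ; ∷-injectiveʳ)
open import Function using (id; _∘_)
open import Function.Definitions using (Injective)
open import Relation.Binary.Definitions using (tri<; tri≈; tri>)
open import Relation.Binary.PropositionalEquality hiding ([_])
open import Relation.Nullary using (yes; no; contradiction)
open import Relation.Nullary.Decidable using (_×-dec_)
open import Relation.Unary using (Pred; Decidable)

module _ {A : Set} where

  length≤1 : ∀ {xs : List A} → Unique xs → (∀ {x y} → x ∈ xs → y ∈ xs → x ≡ y) → length xs ≤ 1
  length≤1 {[]}         _                 _  = z≤n
  length≤1 {_ ∷ []}     _                 _  = s≤s z≤n
  length≤1 {_ ∷ _ ∷ _} ((x≢y ∷ _) ∷ _) eq = contradiction (eq (here refl) (there (here refl))) x≢y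

  2≤length : ∀ {x y : A} {xs} → x ∈ xs → y ∈ xs → x ≢ y → 2 ≤ length xs
  2≤length {xs = _ ∷ _ ∷ _} _           _           _   = s≤s (s≤s z≤n)
  2≤length                  (here refl) (here refl) x≢y = contradiction refl x≢y

  module _ {ℓ} {P : Pred A ℓ} (P? : Decidable P) where

    length-filter-≤1 : ∀ {xs} → Unique xs → (∀ {x y} → P x → P y → x ≡ y) → length (filter P? xs) ≤ 1
    length-filter-≤1 {xs} xs! P-unique = length≤1 (Unique.filter⁺ P? xs!)
      (λ x∈ y∈ → P-unique (proj₂ (∈-filter⁻ P? {xs = xs} x∈)) (proj₂ (∈-filter⁻ P? {xs = xs} y∈)))

    2≤length-filter : ∀ {x y xs} → x ∈ xs → y ∈ xs → x ≢ y → P x → P y → 2 ≤ length (filter P? xs)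
    2≤length-filter x∈ y∈ x≢y px py = 2≤length (∈-filter⁺ P? x∈ px) (∈-filter⁺ P? y∈ py) x≢y

    length-filter-++ : ∀ xs ys → length (filter P? (xs ++ ys)) ≡ length (filter P? xs) + length (filter P? ys)
    length-filter-++ xs ys = trans (cong length (filter-++ P? xs ys)) (length-++ (filter P? xs))

    length-filter-concatMap : ∀ {B : Set} (f : B → List A) xs →
      length (filter P? (concatMap f xs)) ≡ sum (map (λ x → length (filter P? (f x))) xs)
    length-filter-concatMap f []       = refl
    length-filter-concatMap f (x ∷ xs) =
      trans (length-filter-++ (f x) (concatMap f xs)) (cong (_ +_) (length-filter-concatMap f xs))

    length-filter-map : ∀ {B : Set} (f : B → A) xs → length (filter P? (map f xs)) ≡ length (filter (P? ∘ f) xs)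
    length-filter-map f []       = refl
    length-filter-map f (x ∷ xs) with P? (f x)
    ... | yes _ = cong suc (length-filter-map f xs)
    ... | no  _ = length-filter-map f xs

  length-concatMap : ∀ {B : Set} (f : B → List A) xs → length (concatMap f xs) ≡ sum (map (λ x → length (f x)) xs)
  length-concatMap f []       = refl
  length-concatMap f (x ∷ xs) = trans (length-++ (f x)) (cong (_ +_) (length-concatMap f xs))

  sum-map-+ : ∀ (f g : A → ℕ) xs → sum (map (λ x → f x + g x) xs) ≡ sum (map f xs) + sum (map g xs)
  sum-map-+ f g []       = refl
  sum-map-+ f g (x ∷ xs) = trans (cong (f x + g x +_) (sum-map-+ f g xs)) (interchange (f x) (g x) _ _)

  sum-map-const : ∀ {f : A → ℕ} {c} xs → (∀ x → f x ≡ c) → sum (map f xs) ≡ length xs * c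
  sum-map-const []       _   = refl
  sum-map-const (x ∷ xs) f≡c = cong₂ _+_ (f≡c x) (sum-map-const xs f≡c)

  sum-map-≤length : ∀ (g : A → ℕ) xs → (∀ x → g x ≤ 1) → sum (map g xs) ≤ length xs
  sum-map-≤length g []       _   = z≤n
  sum-map-≤length g (x ∷ xs) g≤1 = +-mono-≤ (g≤1 x) (sum-map-≤length g xs g≤1)

  sum≡length⇒≡1 : ∀ (g : A → ℕ) xs → (∀ x → g x ≤ 1) → sum (map g xs) ≡ length xs → ∀ {x} → x ∈ xs → g x ≡ 1
  sum≡length⇒≡1 g (y ∷ ys) g≤1 Σ≡ x∈ with split (g y) (g≤1 y) (sum-map-≤length g ys g≤1) Σ≡
    where
    split : ∀ a {b n} → a ≤ 1 → b ≤ n → a + b ≡ suc n → a ≡ 1 × b ≡ n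
    split 0             _        b≤n refl = contradiction b≤n 1+n≰n
    split 1             _        _   eq   = refl , suc-injective eq
    split (suc (suc _)) (s≤s ()) _   _
  sum≡length⇒≡1 g (y ∷ ys) g≤1 Σ≡ (here refl)  | gy≡1 , _  = gy≡1
  sum≡length⇒≡1 g (y ∷ ys) g≤1 Σ≡ (there x∈)   | _ , Σys≡ = sum≡length⇒≡1 g ys g≤1 Σys≡ x∈

sum-tabulate-const : ∀ {n} {g : Fin n → ℕ} {c} → (∀ j → g j ≡ c) → sum (tabulate g) ≡ n * c
sum-tabulate-const {zero}  _   = refl
sum-tabulate-const {suc n} g≡c = cong₂ _+_ (g≡c zero) (sum-tabulate-const (g≡c ∘ suc))

sum-tabulate-≥ : ∀ {n} (g : Fin n → ℕ) k → k ≤ n → (∀ j → toℕ j < k → 1 ≤ g j) → k ≤ sum (tabulate g)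
sum-tabulate-≥ g zero _ _ = z≤n
sum-tabulate-≥ {suc n} g (suc k) (s≤s k≤n) g≥1 =
  +-mono-≤ (g≥1 zero z<s) (sum-tabulate-≥ (g ∘ suc) k k≤n (λ j j<k → g≥1 (suc j) (s≤s j<k)))

module _ {m : ℕ} {A : Set} where

  fibreSize : (A → Fin m) → Fin m → List A → ℕ
  fibreSize f i xs = length (filter (λ x → f x ≟ᶠ i) xs)

  fibreSize-cong : ∀ {f g : A → Fin m} → f ≗ g → ∀ i xs → fibreSize f i xs ≡ fibreSize g i xs
  fibreSize-cong {f} {g} f≗g i xs = cong length (filter-≐ (λ x → f x ≟ᶠ i) (λ x → g x ≟ᶠ i)
    ((λ {x} e → trans (sym (f≗g x)) e) , (λ {x} e → trans (f≗g x) e)) xs)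

  sum-fibreSize : ∀ (f : A → Fin m) xs → sum (map (λ i → fibreSize f i xs) (allFin m)) ≡ length xs
  sum-fibreSize f [] = trans (sum-map-const (allFin m) (λ _ → refl)) (*-zeroʳ (length (allFin m)))
  sum-fibreSize f (x ∷ xs) = begin
    sum (map (λ i → fibreSize f i (x ∷ xs)) (allFin m))
      ≡⟨ cong sum (map-cong (λ i → length-filter-++ (λ y → f y ≟ᶠ i) [ x ] xs) (allFin m)) ⟩
    sum (map (λ i → fibreSize f i [ x ] + fibreSize f i xs) (allFin m))
      ≡⟨ sum-map-+ (λ i → fibreSize f i [ x ]) (λ i → fibreSize f i xs) (allFin m) ⟩
    sum (map (λ i → fibreSize f i [ x ]) (allFin m)) + sum (map (λ i → fibreSize f i xs) (allFin m))
      ≡⟨ cong₂ _+_ (trans (sum-fibreSize-singleton x (allFin m)) (length-filter-≟-allFin (f x))) (sum-fibreSize f xs) ⟩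
    suc (length xs) ∎
    where
    open ≡-Reasoning
    sum-fibreSize-singleton : ∀ x is → sum (map (λ i → fibreSize f i [ x ]) is) ≡ length (filter (f x ≟ᶠ_) is)
    sum-fibreSize-singleton x []       = refl
    sum-fibreSize-singleton x (i ∷ is) with f x ≟ᶠ i
    ... | yes _ = cong suc (sum-fibreSize-singleton x is)
    ... | no  _ = sum-fibreSize-singleton x is
    length-filter-≟-allFin : ∀ y → length (filter (y ≟ᶠ_) (allFin m)) ≡ 1
    length-filter-≟-allFin y = ≤-antisym
      (length-filter-≤1 (y ≟ᶠ_) (Unique.allFin⁺ m) (λ y≡i y≡j → trans (sym y≡i) y≡j))
      (filter-some (y ≟ᶠ_) (∈-allFin y))

fibreSize-injective : ∀ {m} {f : Fin m → Fin m} → Injective _≡_ _≡_ f → ∀ i → fibreSize f i (allFin m) ≡ 1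
fibreSize-injective {m} {f} f-inj i = sum≡length⇒≡1 (λ j → fibreSize f j (allFin m)) (allFin m)
  (λ j → length-filter-≤1 (λ a → f a ≟ᶠ j) (Unique.allFin⁺ m) (λ fa≡j fb≡j → f-inj (trans fa≡j (sym fb≡j))))
  (sum-fibreSize f (allFin m)) (∈-allFin i)

∣m-n∣≡[m∸n]+[n∸m] : ∀ m n → ∣ m - n ∣ ≡ (m ∸ n) + (n ∸ m)
∣m-n∣≡[m∸n]+[n∸m] zero    zero    = refl
∣m-n∣≡[m∸n]+[n∸m] zero    (suc n) = refl
∣m-n∣≡[m∸n]+[n∸m] (suc m) zero    = sym (+-identityʳ (suc m))
∣m-n∣≡[m∸n]+[n∸m] (suc m) (suc n) = ∣m-n∣≡[m∸n]+[n∸m] m n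

m+[n∸m]≡n+[m∸n] : ∀ m n → m + (n ∸ m) ≡ n + (m ∸ n)
m+[n∸m]≡n+[m∸n] zero    zero    = refl
m+[n∸m]≡n+[m∸n] zero    (suc n) = sym (+-identityʳ (suc n))
m+[n∸m]≡n+[m∸n] (suc m) zero    = +-identityʳ (suc m)
m+[n∸m]≡n+[m∸n] (suc m) (suc n) = cong suc (m+[n∸m]≡n+[m∸n] m n)

-- The deficits below the mean M balance the excesses above it.
sum-∣f-M∣≡excess+excess : ∀ {A : Set} (f : A → ℕ) M xs → sum (map f xs) ≡ length xs * M →
  sum (map (λ x → ∣ f x - M ∣) xs) ≡ sum (map (λ x → f x ∸ M) xs) + sum (map (λ x → f x ∸ M) xs)
sum-∣f-M∣≡excess+excess f M xs Σf≡ = begin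
  sum (map (λ x → ∣ f x - M ∣) xs) ≡⟨ cong sum (map-cong (λ x → ∣m-n∣≡[m∸n]+[n∸m] (f x) M) xs) ⟩
  sum (map (λ x → (f x ∸ M) + (M ∸ f x)) xs) ≡⟨ sum-map-+ (λ x → f x ∸ M) (λ x → M ∸ f x) xs ⟩
  excess + deficit ≡⟨ cong (excess +_) deficit≡excess ⟩
  excess + excess ∎
  where
  open ≡-Reasoning
  excess deficit : ℕ
  excess  = sum (map (λ x → f x ∸ M) xs)
  deficit = sum (map (λ x → M ∸ f x) xs)
  deficit≡excess : deficit ≡ excess
  deficit≡excess = +-cancelˡ-≡ (length xs * M) deficit excess (begin
    length xs * M + deficit                  ≡⟨ cong (_+ deficit) Σf≡ ⟨
    sum (map f xs) + deficit                 ≡⟨ sum-map-+ f (λ x → M ∸ f x) xs ⟨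
    sum (map (λ x → f x + (M ∸ f x)) xs)     ≡⟨ cong sum (map-cong (λ x → m+[n∸m]≡n+[m∸n] (f x) M) xs) ⟩
    sum (map (λ x → M + (f x ∸ M)) xs)       ≡⟨ sum-map-+ (λ _ → M) (λ x → f x ∸ M) xs ⟩
    sum (map (λ _ → M) xs) + excess          ≡⟨ cong (_+ excess) (sum-map-const xs (λ _ → refl)) ⟩
    length xs * M + excess                   ∎)

[m+n]%d≡m%d⇒d∣n : ∀ m n d .{{_ : NonZero d}} → (m + n) % d ≡ m % d → d ∣ n
[m+n]%d≡m%d⇒d∣n m n d eq = ∣m+n∣m⇒∣n (subst (d ∣_) (sym quotients) (n∣m*n ((m + n) / d))) (n∣m*n (m / d))
  where
  open ≡-Reasoning
  quotients : m / d * d + n ≡ (m + n) / d * d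
  quotients = +-cancelˡ-≡ (m % d) _ _ (begin
    m % d + (m / d * d + n)        ≡⟨ +-assoc (m % d) _ n ⟨
    m % d + m / d * d + n          ≡⟨ cong (_+ n) (m≡m%n+[m/n]*n m d) ⟨
    m + n                          ≡⟨ m≡m%n+[m/n]*n (m + n) d ⟩
    (m + n) % d + (m + n) / d * d  ≡⟨ cong (_+ (m + n) / d * d) eq ⟩
    m % d + (m + n) / d * d        ∎)

[m+n]%d≢m%d : ∀ m {n d} .{{_ : NonZero d}} → 0 < n → n < d → (m + n) % d ≢ m % d
[m+n]%d≢m%d m {suc n} {d} _ n<d eq = <⇒≱ n<d (∣⇒≤ ([m+n]%d≡m%d⇒d∣n m (suc n) d eq))

[m+o]%d≢[n+o]%d : ∀ {m n} o {d} .{{_ : NonZero d}} → m < n → n < d → (m + o) % d ≢ (n + o) % d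
[m+o]%d≢[n+o]%d {m} {n} o {d} m<n n<d eq =
  [m+n]%d≢m%d (m + o) (m<n⇒0<n∸m m<n) (≤-<-trans (m∸n≤m n m) n<d) (trans (cong (_% d) shift) (sym eq))
  where
  shift : (m + o) + (n ∸ m) ≡ n + o
  shift = trans (xy∙z≈xz∙y m o (n ∸ m)) (cong (_+ o) (m+[n∸m]≡n (<⇒≤ m<n)))

[m+o]%d≡[n+o]%d⇒m≡n : ∀ {m n o d} .{{_ : NonZero d}} → m < d → n < d → (m + o) % d ≡ (n + o) % d → m ≡ n
[m+o]%d≡[n+o]%d⇒m≡n {m} {n} {o} m<d n<d eq with <-cmp m n
... | tri< m<n _ _ = contradiction eq ([m+o]%d≢[n+o]%d o m<n n<d)
... | tri≈ _ m≡n _ = m≡n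
... | tri> _ _ n<m = contradiction (sym eq) ([m+o]%d≢[n+o]%d o n<m m<d)

⌈m/2⌉+⌊n/2⌋<d : ∀ {m n d} → m < d → n < d → ⌈ m /2⌉ + ⌊ n /2⌋ < d
⌈m/2⌉+⌊n/2⌋<d {m} {n} {suc d} (s≤s m≤d) (s≤s n≤d) = s≤s (begin
  ⌈ m /2⌉ + ⌊ n /2⌋  ≤⟨ +-mono-≤ (⌈n/2⌉-mono m≤d) (⌊n/2⌋-mono n≤d) ⟩
  ⌈ d /2⌉ + ⌊ d /2⌋  ≡⟨ +-comm ⌈ d /2⌉ ⌊ d /2⌋ ⟩
  ⌊ d /2⌋ + ⌈ d /2⌉  ≡⟨ ⌊n/2⌋+⌈n/2⌉≡n d ⟩
  d                  ∎)
  where open ≤-Reasoning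

⌈m/2⌉≡⌈n/2⌉⇒1+m+n≡4*⌈n/2⌉ : ∀ {m n} → ⌈ m /2⌉ ≡ ⌈ n /2⌉ → m ≢ n → suc (m + n) ≡ 4 * ⌈ n /2⌉
⌈m/2⌉≡⌈n/2⌉⇒1+m+n≡4*⌈n/2⌉ {0}                 {0}                 _  0≢0 = contradiction refl 0≢0
⌈m/2⌉≡⌈n/2⌉⇒1+m+n≡4*⌈n/2⌉ {1}                 {1}                 _  1≢1 = contradiction refl 1≢1
⌈m/2⌉≡⌈n/2⌉⇒1+m+n≡4*⌈n/2⌉ {1}                 {2}                 _  _   = refl
⌈m/2⌉≡⌈n/2⌉⇒1+m+n≡4*⌈n/2⌉ {2}                 {1}                 _  _   = refl
⌈m/2⌉≡⌈n/2⌉⇒1+m+n≡4*⌈n/2⌉ {suc (suc m)}       {suc (suc n)}       eq m≢n = begin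
  suc (suc (suc m) + suc (suc n))  ≡⟨ cong (3 +_) (trans (+-suc m (suc n)) (cong suc (+-suc m n))) ⟩
  4 + suc (m + n)                  ≡⟨ cong (4 +_) (⌈m/2⌉≡⌈n/2⌉⇒1+m+n≡4*⌈n/2⌉ (suc-injective eq) (m≢n ∘ cong (2 +_))) ⟩
  4 + 4 * ⌈ n /2⌉                  ≡⟨ *-suc 4 ⌈ n /2⌉ ⟨
  4 * ⌈ suc (suc n) /2⌉            ∎
  where open ≡-Reasoning
⌈m/2⌉≡⌈n/2⌉⇒1+m+n≡4*⌈n/2⌉ {0}                 {suc _}             ()
⌈m/2⌉≡⌈n/2⌉⇒1+m+n≡4*⌈n/2⌉ {suc _}             {0}                 ()
⌈m/2⌉≡⌈n/2⌉⇒1+m+n≡4*⌈n/2⌉ {1}                 {suc (suc (suc _))} ()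
⌈m/2⌉≡⌈n/2⌉⇒1+m+n≡4*⌈n/2⌉ {suc (suc (suc _))} {1}                 ()

⌈/2⌉-twin : ∀ {a b c} → ⌈ a /2⌉ ≡ ⌈ c /2⌉ → ⌈ b /2⌉ ≡ ⌈ c /2⌉ → a ≢ c → b ≢ c → a ≡ b
⌈/2⌉-twin {a} {b} {c} a~c b~c a≢c b≢c = +-cancelʳ-≡ c a b (suc-injective
  (trans (⌈m/2⌉≡⌈n/2⌉⇒1+m+n≡4*⌈n/2⌉ a~c a≢c) (sym (⌈m/2⌉≡⌈n/2⌉⇒1+m+n≡4*⌈n/2⌉ b~c b≢c))))

module _ {m : ℕ} where

  ∈-allVertices : ∀ {n} (v : Vertex n m) → v ∈ allVertices n m
  ∈-allVertices []                = here refl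
  ∈-allVertices {suc n} (x ∷ v) =
    ∈-concat⁺′ (∈-map⁺ (x ∷_) (∈-allVertices v)) (∈-map⁺ (λ a → map (a ∷_) (allVertices n m)) (∈-allFin x))

  allVertices-unique : ∀ n → Unique (allVertices n m)
  allVertices-unique zero    = [] ∷ []
  allVertices-unique (suc n) = Unique.concat⁺
    (AllP.map⁺ (All.universal (λ a → Unique.map⁺ ∷-injectiveʳ (allVertices-unique n)) (allFin m)))
    (AllPairsP.map⁺ (AllPairs.map disjoint (Unique.allFin⁺ m)))
    where
    disjoint : ∀ {a b : Fin m} → a ≢ b → Disjoint (map (a ∷_) (allVertices n m)) (map (b ∷_) (allVertices n m))
    disjoint a≢b (v∈a , v∈b) with ∈-map⁻ _ v∈a | ∈-map⁻ _ v∈b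
    ... | _ , _ , refl | _ , _ , a∷u≡b∷w = a≢b (∷-injectiveˡ a∷u≡b∷w)

  length-allVertices : ∀ n → length (allVertices n m) ≡ m ^ n
  length-allVertices zero    = refl
  length-allVertices (suc n) = begin
    length (allVertices (suc n) m)                                   ≡⟨ length-concatMap (λ a → map (a ∷_) (allVertices n m)) (allFin m) ⟩
    sum (map (λ a → length (map (a ∷_) (allVertices n m))) (allFin m)) ≡⟨ sum-map-const (allFin m) (λ a → trans (length-map (a ∷_) (allVertices n m)) (length-allVertices n)) ⟩
    length (allFin m) * m ^ n                                         ≡⟨ cong (_* m ^ n) (length-tabulate {n = m} id) ⟩
    m * m ^ n                                                         ∎
    where open ≡-Reasoning

  fibreSize-allVertices-suc : ∀ {n} (f : Vertex (suc n) m → Fin m) i →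
    fibreSize f i (allVertices (suc n) m) ≡ sum (map (λ a → fibreSize (f ∘ (a ∷_)) i (allVertices n m)) (allFin m))
  fibreSize-allVertices-suc {n} f i =
    trans (length-filter-concatMap (λ v → f v ≟ᶠ i) (λ a → map (a ∷_) (allVertices n m)) (allFin m))
          (cong sum (map-cong (λ a → length-filter-map (λ v → f v ≟ᶠ i) (a ∷_) (allVertices n m)) (allFin m)))

  allVertices-1 : allVertices 1 m ≡ map Vec.[_] (allFin m)
  allVertices-1 = concatMap-singleton (allFin m)
    where
    concatMap-singleton : ∀ as → concatMap (λ a → map (a ∷_) (allVertices 0 m)) as ≡ map Vec.[_] as
    concatMap-singleton []       = refl
    concatMap-singleton (a ∷ as) = cong (Vec.[ a ] ∷_) (concatMap-singleton as)

  hammingDist≡0⇒≡ : ∀ {n} {u w : Vertex n m} → hammingDist u w ≡ 0 → u ≡ w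
  hammingDist≡0⇒≡ {u = []}    {[]}    _ = refl
  hammingDist≡0⇒≡ {u = x ∷ u} {y ∷ w} d≡0 with x ≟ᶠ y
  hammingDist≡0⇒≡ {u = x ∷ u} {.x ∷ w} d≡0 | yes refl = cong (x ∷_) (hammingDist≡0⇒≡ d≡0)
  hammingDist≡0⇒≡ {u = x ∷ u} {y ∷ w}  () | no _

  adjacent-∷⁻ : ∀ {n} {x y} {u w : Vertex n m} → Adjacent (x ∷ u) (y ∷ w) → (x ≡ y × Adjacent u w) ⊎ (x ≢ y × u ≡ w)
  adjacent-∷⁻ {x = x} {y} adj with x ≟ᶠ y
  ... | yes x≡y = inj₁ (x≡y , adj)
  ... | no  x≢y = inj₂ (x≢y , hammingDist≡0⇒≡ (suc-injective adj))

mod≡⇒%≡ : ∀ a b {m} .{{_ : NonZero m}} → a mod m ≡ b mod m → a % m ≡ b % m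
mod≡⇒%≡ a b {m} eq = trans (sym (toℕ-fromℕ< (m%n<n a m))) (trans (cong toℕ eq) (toℕ-fromℕ< (m%n<n b m)))

module Colouring (m′ : ℕ) where

  private
    m : ℕ
    m = suc m′

  coordSum : ∀ {n} → Vertex n m → ℕ
  coordSum []      = 0
  coordSum (x ∷ v) = toℕ x + coordSum v

  leading : ∀ {n} → Vertex n m → Fin m
  leading []          = zero
  leading (zero ∷ v)  = leading v
  leading (suc x ∷ v) = suc x

  label : ∀ {n} → Vertex n m → ℕ
  label []          = 0
  label (zero ∷ v)  = label v
  label (suc x ∷ v) = ⌈ toℕ (suc x) /2⌉ + coordSum v

  colouring : ∀ {n} → Partition n m
  colouring v = label v mod m

  label+⌊leading/2⌋≡coordSum : ∀ {n} (v : Vertex n m) → label v + ⌊ toℕ (leading v) /2⌋ ≡ coordSum v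
  label+⌊leading/2⌋≡coordSum []          = refl
  label+⌊leading/2⌋≡coordSum (zero ∷ v)  = label+⌊leading/2⌋≡coordSum v
  label+⌊leading/2⌋≡coordSum (suc x ∷ v) = begin
    ⌈ t /2⌉ + coordSum v + ⌊ t /2⌋  ≡⟨ xy∙z≈xz∙y ⌈ t /2⌉ (coordSum v) ⌊ t /2⌋ ⟩
    ⌈ t /2⌉ + ⌊ t /2⌋ + coordSum v  ≡⟨ cong (_+ coordSum v) (trans (+-comm ⌈ t /2⌉ ⌊ t /2⌋) (⌊n/2⌋+⌈n/2⌉≡n t)) ⟩
    t + coordSum v                  ∎
    where
    open ≡-Reasoning
    t = toℕ (suc x)

  -- Turning a leading zero into y ≠ 0 raises the label by ⌈ y /2⌉ + ⌊ leading u /2⌋, which lies in [1, m).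
  label-suc∷≢label : ∀ {n} (y : Fin m′) (u : Vertex n m) → (⌈ toℕ (suc y) /2⌉ + coordSum u) % m ≢ label u % m
  label-suc∷≢label y u eq = [m+n]%d≢m%d (label u) (s≤s z≤n)
    (⌈m/2⌉+⌊n/2⌋<d (toℕ<n (suc y)) (toℕ<n (leading u))) (trans (cong (_% m) raise) eq)
    where
    raise : label u + (⌈ toℕ (suc y) /2⌉ + ⌊ toℕ (leading u) /2⌋) ≡ ⌈ toℕ (suc y) /2⌉ + coordSum u
    raise = trans (x∙yz≈y∙xz (label u) ⌈ toℕ (suc y) /2⌉ ⌊ toℕ (leading u) /2⌋)
      (cong (⌈ toℕ (suc y) /2⌉ +_) (label+⌊leading/2⌋≡coordSum u))

  adjacent⇒coordSum-%-≢ : ∀ {n} K (u w : Vertex n m) → Adjacent u w → (K + coordSum u) % m ≢ (K + coordSum w) % m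
  adjacent⇒coordSum-%-≢ K []      []      ()
  adjacent⇒coordSum-%-≢ K (x ∷ u) (y ∷ w) adj with adjacent-∷⁻ {x = x} {y} {u} {w} adj
  ... | inj₁ (refl , adj′) = adjacent⇒coordSum-%-≢ (K + toℕ x) u w adj′ ∘ λ eq →
          trans (cong (_% m) (+-assoc K (toℕ x) (coordSum u))) (trans eq (cong (_% m) (sym (+-assoc K (toℕ x) (coordSum w)))))
  ... | inj₂ (x≢y , refl) = λ eq → x≢y (toℕ-injective ([m+o]%d≡[n+o]%d⇒m≡n (toℕ<n x) (toℕ<n y)
          (trans (cong (_% m) (x∙yz≈y∙xz (toℕ x) K (coordSum u))) (trans eq (cong (_% m) (x∙yz≈y∙xz K (toℕ y) (coordSum u)))))))

  record SameLabelNeighbour {n} (v w : Vertex n m) : Set where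
    constructor sameLabelNeighbour
    field
      adjacent  : Adjacent v w
      sameLabel : label w % m ≡ label v % m

  sameLabelNeighbour-zero∷ : ∀ {n} {u w : Vertex n m} {y} → SameLabelNeighbour (zero ∷ u) (y ∷ w) → y ≡ zero × SameLabelNeighbour u w
  sameLabelNeighbour-zero∷ {u = u} {w} {y} (sameLabelNeighbour adj same) with adjacent-∷⁻ {x = zero} {y} {u} {w} adj
  ... | inj₁ (refl , adj′) = refl , sameLabelNeighbour adj′ same
  sameLabelNeighbour-zero∷ {u = u} {y = zero}  (sameLabelNeighbour adj same) | inj₂ (0≢0 , _)    = contradiction refl 0≢0
  sameLabelNeighbour-zero∷ {u = u} {y = suc y} (sameLabelNeighbour adj same) | inj₂ (_   , refl) = contradiction same (label-suc∷≢label y u)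

  sameLabelNeighbour-suc∷ : ∀ {n} {u w : Vertex n m} {x y} → SameLabelNeighbour (suc x ∷ u) (y ∷ w) →
    w ≡ u × toℕ y ≢ toℕ (suc x) × ⌈ toℕ y /2⌉ ≡ ⌈ toℕ (suc x) /2⌉
  sameLabelNeighbour-suc∷ {u = u} {w} {x} {y} (sameLabelNeighbour adj same) with adjacent-∷⁻ {x = suc x} {y} {u} {w} adj
  ... | inj₁ (refl , adj′) = contradiction (sym same) (adjacent⇒coordSum-%-≢ ⌈ toℕ (suc x) /2⌉ u w adj′)
  sameLabelNeighbour-suc∷ {u = u} {x = x} {zero}  (sameLabelNeighbour adj same) | inj₂ (_ , refl) =
    contradiction (sym same) (label-suc∷≢label x u)
  sameLabelNeighbour-suc∷ {x = x} {suc y} (sameLabelNeighbour adj same) | inj₂ (x≢y , refl) =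
    refl , x≢y ∘ toℕ-injective ∘ sym , [m+o]%d≡[n+o]%d⇒m≡n (≤-<-trans (⌈n/2⌉≤n _) (toℕ<n (suc y))) (≤-<-trans (⌈n/2⌉≤n _) (toℕ<n (suc x))) same

  sameLabelNeighbour-unique : ∀ {n} {v w₁ w₂ : Vertex n m} → SameLabelNeighbour v w₁ → SameLabelNeighbour v w₂ → w₁ ≡ w₂
  sameLabelNeighbour-unique {v = []} {[]} (sameLabelNeighbour () _)
  sameLabelNeighbour-unique {v = zero ∷ u} {y₁ ∷ w₁} {y₂ ∷ w₂} n₁ n₂
    with sameLabelNeighbour-zero∷ {u = u} {w₁} {y₁} n₁ | sameLabelNeighbour-zero∷ {u = u} {w₂} {y₂} n₂
  ... | refl , n₁′ | refl , n₂′ = cong (zero ∷_) (sameLabelNeighbour-unique n₁′ n₂′)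
  sameLabelNeighbour-unique {v = suc x ∷ u} {y₁ ∷ w₁} {y₂ ∷ w₂} n₁ n₂
    with sameLabelNeighbour-suc∷ {u = u} {w₁} {x} {y₁} n₁ | sameLabelNeighbour-suc∷ {u = u} {w₂} {x} {y₂} n₂
  ... | refl , y₁≢x , y₁~x | refl , y₂≢x , y₂~x = cong (_∷ u) (toℕ-injective (⌈/2⌉-twin y₁~x y₂~x y₁≢x y₂≢x))

  colouring-maxDegree≤1 : ∀ {n} → MaxDegreeAtMost (colouring {n}) 1
  colouring-maxDegree≤1 {n} v = length-filter-≤1 (λ w → adjacent? v w ×-dec (colouring w ≟ᶠ colouring v))
    (allVertices-unique n) (λ {w₁} {w₂} (adj₁ , eq₁) (adj₂ , eq₂) → sameLabelNeighbour-unique {v = v}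
      (sameLabelNeighbour adj₁ (mod≡⇒%≡ (label w₁) (label v) eq₁)) (sameLabelNeighbour adj₂ (mod≡⇒%≡ (label w₂) (label v) eq₂)))

  shiftedCoordSum-fibreSize : ∀ n K i → fibreSize (λ u → (K + coordSum u) mod m) i (allVertices (suc n) m) ≡ m ^ n
  shiftedCoordSum-fibreSize zero K i = begin
    fibreSize (λ u → (K + coordSum u) mod m) i (allVertices 1 m)
      ≡⟨ cong (fibreSize (λ u → (K + coordSum u) mod m) i) allVertices-1 ⟩
    fibreSize (λ u → (K + coordSum u) mod m) i (map Vec.[_] (allFin m))
      ≡⟨ length-filter-map (λ u → (K + coordSum u) mod m ≟ᶠ i) Vec.[_] (allFin m) ⟩
    fibreSize (λ a → (K + (toℕ a + 0)) mod m) i (allFin m)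
      ≡⟨ fibreSize-injective shift-injective i ⟩
    1 ∎
    where
    open ≡-Reasoning
    shift-injective : Injective _≡_ _≡_ (λ (a : Fin m) → (K + (toℕ a + 0)) mod m)
    shift-injective {a} {b} eq = toℕ-injective ([m+o]%d≡[n+o]%d⇒m≡n (toℕ<n a) (toℕ<n b)
      (trans (cong (_% m) (reorder a)) (trans (mod≡⇒%≡ (K + (toℕ a + 0)) (K + (toℕ b + 0)) eq) (cong (_% m) (sym (reorder b))))))
      where
      reorder : ∀ (c : Fin m) → toℕ c + K ≡ K + (toℕ c + 0)
      reorder c = trans (+-comm (toℕ c) K) (cong (K +_) (sym (+-identityʳ (toℕ c))))
  shiftedCoordSum-fibreSize (suc n) K i = begin
    fibreSize (λ u → (K + coordSum u) mod m) i (allVertices (suc (suc n)) m)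
      ≡⟨ fibreSize-allVertices-suc {n = suc n} (λ u → (K + coordSum u) mod m) i ⟩
    sum (map (λ a → fibreSize (λ u → (K + (toℕ a + coordSum u)) mod m) i (allVertices (suc n) m)) (allFin m))
      ≡⟨ sum-map-const (allFin m) (λ a → trans
           (fibreSize-cong (λ u → cong (_mod m) (sym (+-assoc K (toℕ a) (coordSum u)))) i (allVertices (suc n) m))
           (shiftedCoordSum-fibreSize n (K + toℕ a) i)) ⟩
    length (allFin m) * m ^ n
      ≡⟨ cong (_* m ^ n) (length-tabulate {n = m} id) ⟩
    m * m ^ n ∎
    where open ≡-Reasoning

  partSize-suc : ∀ n i → partSize (colouring {suc (suc n)}) i ≡ partSize (colouring {suc n}) i + m′ * m ^ n
  partSize-suc n i = begin
    partSize (colouring {suc (suc n)}) i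
      ≡⟨ fibreSize-allVertices-suc {n = suc n} colouring i ⟩
    partSize (colouring {suc n}) i + sum (map F (tabulate suc))
      ≡⟨ cong (partSize (colouring {suc n}) i +_) (trans (cong sum (map-tabulate suc F))
           (sum-tabulate-const {g = F ∘ suc} (λ y → shiftedCoordSum-fibreSize n ⌈ toℕ (suc y) /2⌉ i))) ⟩
    partSize (colouring {suc n}) i + m′ * m ^ n ∎
    where
    open ≡-Reasoning
    F : Fin m → ℕ
    F a = fibreSize (colouring ∘ (a ∷_)) i (allVertices (suc n) m)

  label-[_] : ∀ (a : Fin m) → label Vec.[ a ] ≡ ⌈ toℕ a /2⌉
  label-[ zero ]  = refl
  label-[ suc a ] = +-identityʳ _

  label≡⇒colouring≡ : ∀ {n} {v : Vertex n m} {i} → label v ≡ toℕ i → colouring v ≡ i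
  label≡⇒colouring≡ {v = v} {i} eq =
    toℕ-injective (trans (toℕ-fromℕ< (m%n<n (label v) m)) (trans (cong (_% m) eq) (m<n⇒m%n≡m (toℕ<n i))))

  -- The part with label s + 1 contains both words 2s + 1 and 2s + 2 of length one.
  partSize-1 : ∀ (j : Fin m′) → toℕ j < ⌊ m′ /2⌋ → 2 ≤ partSize (colouring {1}) (suc j)
  partSize-1 j j<k = 2≤length-filter (λ v → colouring v ≟ᶠ suc j)
    (∈-allVertices Vec.[ odd ]) (∈-allVertices Vec.[ even ]) odd≢even
    (label≡⇒colouring≡ {v = Vec.[ odd ]} (trans label-[ odd ]  (trans (cong ⌈_/2⌉ (toℕ-fromℕ< 2s+1<m)) (cong suc (sym (n≡⌊n+n/2⌋ s))))))
    (label≡⇒colouring≡ {v = Vec.[ even ]} (trans label-[ even ] (trans (cong ⌈_/2⌉ (toℕ-fromℕ< 2s+2<m)) (cong suc (sym (n≡⌈n+n/2⌉ s))))))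
    where
    s = toℕ j
    2s+2<m : suc (suc (s + s)) < m
    2s+2<m = s≤s (begin
      suc (suc (s + s))       ≡⟨ cong suc (+-suc s s) ⟨
      suc s + suc s           ≤⟨ +-mono-≤ j<k j<k ⟩
      ⌊ m′ /2⌋ + ⌊ m′ /2⌋     ≤⟨ +-monoʳ-≤ ⌊ m′ /2⌋ (⌊n/2⌋≤⌈n/2⌉ m′) ⟩
      ⌊ m′ /2⌋ + ⌈ m′ /2⌉     ≡⟨ ⌊n/2⌋+⌈n/2⌉≡n m′ ⟩
      m′                      ∎)
      where open ≤-Reasoning
    2s+1<m : suc (s + s) < m
    2s+1<m = <-trans (n<1+n _) 2s+2<m
    odd even : Fin m
    odd  = fromℕ< 2s+1<m
    even = fromℕ< 2s+2<m
    odd≢even : Vec.[ odd ] ≢ Vec.[ even ]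
    odd≢even eq = 1+n≢n
      (sym (trans (sym (toℕ-fromℕ< 2s+1<m)) (trans (cong toℕ (∷-injectiveˡ eq)) (toℕ-fromℕ< 2s+2<m))))

  partSize-large : ∀ n (j : Fin m′) → toℕ j < ⌊ m′ /2⌋ → m ^ n < partSize (colouring {suc n}) (suc j)
  partSize-large zero    j j<k = partSize-1 j j<k
  partSize-large (suc n) j j<k = begin-strict
    m ^ n + m′ * m ^ n                                   <⟨ +-monoˡ-< (m′ * m ^ n) (partSize-large n j j<k) ⟩
    partSize (colouring {suc n}) (suc j) + m′ * m ^ n    ≡⟨ partSize-suc n (suc j) ⟨
    partSize (colouring {suc (suc n)}) (suc j)           ∎
    where open ≤-Reasoning

  ⌊m′/2⌋+⌊m′/2⌋≤imbalance : ∀ n → ⌊ m′ /2⌋ + ⌊ m′ /2⌋ ≤ imbalance (colouring {suc n})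
  ⌊m′/2⌋+⌊m′/2⌋≤imbalance n = begin
    ⌊ m′ /2⌋ + ⌊ m′ /2⌋            ≤⟨ +-mono-≤ k≤excess k≤excess ⟩
    excess + excess                ≡⟨ sum-∣f-M∣≡excess+excess size (m ^ n) (allFin m) total ⟨
    imbalance (colouring {suc n})  ∎
    where
    open ≤-Reasoning
    size : Fin m → ℕ
    size = partSize (colouring {suc n})
    excess : ℕ
    excess = sum (map (λ i → size i ∸ m ^ n) (allFin m))
    total : sum (map size (allFin m)) ≡ length (allFin m) * m ^ n
    total = trans (sum-fibreSize colouring (allVertices (suc n) m))
      (trans (length-allVertices (suc n)) (cong (_* m ^ n) (sym (length-tabulate {n = m} id))))
    k≤excess : ⌊ m′ /2⌋ ≤ excess
    k≤excess = ≤-trans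
      (sum-tabulate-≥ (λ j → size (suc j) ∸ m ^ n) ⌊ m′ /2⌋ (⌊n/2⌋≤n m′)
        (λ j j<k → m<n⇒0<n∸m (partSize-large n j j<k)))
      (≤-trans (≤-reflexive (sym (cong sum (map-tabulate suc (λ i → size i ∸ m ^ n))))) (m≤n+m _ _))

n≤1+⌊n/2⌋+⌊n/2⌋ : ∀ n → n ≤ suc (⌊ n /2⌋ + ⌊ n /2⌋)
n≤1+⌊n/2⌋+⌊n/2⌋ 0             = z≤n
n≤1+⌊n/2⌋+⌊n/2⌋ 1             = s≤s z≤n
n≤1+⌊n/2⌋+⌊n/2⌋ (suc (suc n)) =
  s≤s (≤-trans (s≤s (n≤1+⌊n/2⌋+⌊n/2⌋ n)) (≤-reflexive (cong suc (sym (+-suc ⌊ n /2⌋ ⌊ n /2⌋)))))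

¬2∣1+n⇒n≤⌊n/2⌋+⌊n/2⌋ : ∀ n → ¬ 2 ∣ suc n → n ≤ ⌊ n /2⌋ + ⌊ n /2⌋
¬2∣1+n⇒n≤⌊n/2⌋+⌊n/2⌋ 0             _     = z≤n
¬2∣1+n⇒n≤⌊n/2⌋+⌊n/2⌋ 1             2∤2   = contradiction ∣-refl 2∤2
¬2∣1+n⇒n≤⌊n/2⌋+⌊n/2⌋ (suc (suc n)) 2∤3+n =
  s≤s (≤-trans (s≤s (¬2∣1+n⇒n≤⌊n/2⌋+⌊n/2⌋ n (2∤3+n ∘ ∣m∣n⇒∣m+n ∣-refl))) (≤-reflexive (sym (+-suc ⌊ n /2⌋ ⌊ n /2⌋))))

-- The construction only needs n ≥ 1.
proposition2p1 : (m n : ℕ) → 1 ≤ m → 2 ≤ n →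
    Σ (Partition n m) (λ Π →
    MaxDegreeAtMost Π 1 ×
    ((2 ∣ m → m ∸ 2 ≤ imbalance Π) × (¬ (2 ∣ m) → m ∸ 1 ≤ imbalance Π)))
proposition2p1 (suc m′) (suc n) _ _ = colouring , colouring-maxDegree≤1 , even , odd
  where
  open Colouring m′
  even : 2 ∣ suc m′ → m′ ∸ 1 ≤ imbalance (colouring {suc n})
  even _ = ≤-trans (∸-monoˡ-≤ 1 (n≤1+⌊n/2⌋+⌊n/2⌋ m′)) (⌊m′/2⌋+⌊m′/2⌋≤imbalance n)
  odd : ¬ 2 ∣ suc m′ → m′ ≤ imbalance (colouring {suc n})
  odd 2∤m = ≤-trans (¬2∣1+n⇒n≤⌊n/2⌋+⌊n/2⌋ m′ 2∤m) (⌊m′/2⌋+⌊m′/2⌋≤imbalance n)
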